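{- Let $\mathbf C$ be a category with a functor $|\cdot|:\mathbf C\to\mathbf{Set}$, assume $\mathbf C$ has binary products, let $F:\mathbf C\to\mathbf C$ be a functor, let $\lambda:\Psi\to\Psi F$ be an indexed morphism with $\lambda_X(\equiv_X)=\,\equiv_{FX}$ for every object $X$, and assume the equality functor $\mathrm{Eq}:\mathbf C\to\int\Psi$ has a left adjoint $\mathrm{Qu}$. Let $\alpha:X\to FX$ be an $F$-coalgebra and let $R\in\Psi X$ satisfy $R\subseteq\alpha^*(\lambda_X R)$. Then there exist an $F$-coalgebra $(Y,\beta)$ and a coalgebra homomorphism $f:(X,\alpha)\to(Y,\beta)$ such that $R\subseteq f^*(\equiv_Y)$. Moreover, if the unit of $\mathrm{Qu}\dashv\mathrm{Eq}$ is Cartesian, then $R=f^*(\equiv_Y)$.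
   Context: Binary products in $\mathbf C$ are written $X\otimes Y$, with projections $\pi_1^X,\pi_2^X:X\otimes X\to X$; for $g:X\to Y$, $g\otimes g$ is the induced morphism. $\Psi X$ is the poset (under $\subseteq$) of subsets of $|X\otimes X|$; for $g:X\to Y$, $g^*:\Psi Y\to\Psi X$ is $g^*(S)=|g\otimes g|^{ -1}(S)$. Abstract equality: $\equiv_X=\langle|\pi_1^X|,|\pi_2^X|\rangle^{ -1}(\{(x,x)\mid x\in|X|\})$. The category $\int\Psi$ has objects $(X,R)$ with $R\in\Psi X$ and morphisms $g:(X,R)\to(Y,S)$ the $\mathbf C$-morphisms $g:X\to Y$ with $R\subseteq g^*S$. The equality functor $\mathrm{Eq}:\mathbf C\to\int\Psi$ is $X\mapsto(X,\equiv_X)$, $g\mapsto g$. An indexed morphism $\lambda:\Psi\to\Psi F$ is a family of monotone maps $\lambda_X:\Psi X\to\Psi(FX)$ with $\lambda_X(g^*S)=(Fg)^*(\lambda_YS)$. A coalgebra homomorphism $f:(X,\alpha)\to(Y,\beta)$ is $f:X\to Y$ with $Ff\circ\alpha=\beta\circ f$. A morphism $g:(X,R)\to(Y,S)$ of $\int\Psi$ is Cartesian if $R=g^*S$; the unit of $\mathrm{Qu}\dashv\mathrm{Eq}$ is Cartesian if all its components $(X,R)\to\mathrm{Eq}(\mathrm{Qu}(X,R))$ are Cartesian. -}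

module Defs where

open import Level using (Level; _⊔_; suc)
open import Relation.Binary.PropositionalEquality using (_≡_)
open import Data.Product using (Σ; _×_; _,_; ∃-syntax)

record Category (o h : Level) : Set (suc (o ⊔ h)) where
  infixr 9 _∘_
  field
    Obj   : Set o
    Hom   : Obj → Obj → Set h
    id    : ∀ {A} → Hom A A
    _∘_   : ∀ {A B C} → Hom B C → Hom A B → Hom A C
    idˡ   : ∀ {A B} (f : Hom A B) → id ∘ f ≡ f
    idʳ   : ∀ {A B} (f : Hom A B) → f ∘ id ≡ f
    assoc : ∀ {A B C D} (f : Hom C D) (g : Hom B C) (k : Hom A B) →
            (f ∘ g) ∘ k ≡ f ∘ (g ∘ k)

module _ {o h : Level} (C : Category o h) where
  open Category C

  record SetFunctor (u : Level) : Set (o ⊔ h ⊔ suc u) where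
    field
      ∣_∣₀  : Obj → Set u
      ∣_∣₁  : ∀ {A B} → Hom A B → ∣_∣₀ A → ∣_∣₀ B
      ∣id∣  : ∀ {A} (x : ∣_∣₀ A) → ∣_∣₁ (id {A}) x ≡ x
      ∣∘∣   : ∀ {A B D} (g : Hom B D) (f : Hom A B) (x : ∣_∣₀ A) →
              ∣_∣₁ (g ∘ f) x ≡ ∣_∣₁ g (∣_∣₁ f x)

  record Endofunctor : Set (o ⊔ h) where
    field
      F₀    : Obj → Obj
      F₁    : ∀ {A B} → Hom A B → Hom (F₀ A) (F₀ B)
      F-id  : ∀ {A} → F₁ (id {A}) ≡ id
      F-∘   : ∀ {A B D} (g : Hom B D) (f : Hom A B) → F₁ (g ∘ f) ≡ F₁ g ∘ F₁ f

  record BinaryProducts : Set (o ⊔ h) where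
    infixr 7 _⊗_
    field
      _⊗_    : Obj → Obj → Obj
      π₁     : ∀ {A B} → Hom (A ⊗ B) A
      π₂     : ∀ {A B} → Hom (A ⊗ B) B
      ⟨_,_⟩  : ∀ {D A B} → Hom D A → Hom D B → Hom D (A ⊗ B)
      π₁-β   : ∀ {D A B} (f : Hom D A) (g : Hom D B) → π₁ ∘ ⟨ f , g ⟩ ≡ f
      π₂-β   : ∀ {D A B} (f : Hom D A) (g : Hom D B) → π₂ ∘ ⟨ f , g ⟩ ≡ g
      unique : ∀ {D A B} (f : Hom D A) (g : Hom D B) (k : Hom D (A ⊗ B)) →
               π₁ ∘ k ≡ f → π₂ ∘ k ≡ g → k ≡ ⟨ f , g ⟩

    _⊗₁_ : ∀ {A B A' B'} → Hom A B → Hom A' B' → Hom (A ⊗ A') (B ⊗ B')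
    f ⊗₁ g = ⟨ f ∘ π₁ , g ∘ π₂ ⟩

  module Relations {u : Level} (U : SetFunctor u) (P : BinaryProducts) where
    open SetFunctor U
    open BinaryProducts P

    Ψ : Obj → Set (suc u)
    Ψ X = ∣ X ⊗ X ∣₀ → Set u

    _⊆_ : ∀ {X} → Ψ X → Ψ X → Set u
    R ⊆ S = ∀ z → R z → S z

    _≐_ : ∀ {X} → Ψ X → Ψ X → Set u
    R ≐ S = (R ⊆ S) × (S ⊆ R)

    _* : ∀ {X Y} → Hom X Y → Ψ Y → Ψ X
    (g *) S z = S (∣ g ⊗₁ g ∣₁ z)

    Eqrel : ∀ X → Ψ X
    Eqrel X z = ∣ π₁ {X} {X} ∣₁ z ≡ ∣ π₂ {X} {X} ∣₁ z

    record IndexedMorphism (F : Endofunctor) : Set (o ⊔ h ⊔ suc u) where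
      open Endofunctor F
      field
        λ₀   : ∀ X → Ψ X → Ψ (F₀ X)
        mono : ∀ {X} {R S : Ψ X} → R ⊆ S → λ₀ X R ⊆ λ₀ X S
        nat  : ∀ {X Y} (g : Hom X Y) (S : Ψ Y) →
               λ₀ X ((g *) S) ≐ ((F₁ g) *) (λ₀ Y S)

    -- A morphism (X,R) → (Y,S) of ∫Ψ is a C-morphism g with R ⊆ g*S.
    -- A left adjoint Qu of Eq : C → ∫Ψ, given by its universal arrows:
    -- the unit η : (X,R) → Eq(Qu(X,R)) and, for every ∫Ψ-morphism
    -- g : (X,R) → Eq Y, a unique h : Qu(X,R) → Y with h ∘ η = g.
    record EqLeftAdjoint : Set (o ⊔ h ⊔ suc u) where
      field
        Qu₀     : (X : Obj) → Ψ X → Obj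
        η       : ∀ X (R : Ψ X) → Hom X (Qu₀ X R)
        η-mor   : ∀ X (R : Ψ X) → R ⊆ ((η X R) *) (Eqrel (Qu₀ X R))
        lift    : ∀ {X Y} (R : Ψ X) (g : Hom X Y) →
                  R ⊆ (g *) (Eqrel Y) → Hom (Qu₀ X R) Y
        lift-β  : ∀ {X Y} (R : Ψ X) (g : Hom X Y) (r : R ⊆ (g *) (Eqrel Y)) →
                  lift R g r ∘ η X R ≡ g
        lift-η  : ∀ {X Y} (R : Ψ X) (g : Hom X Y) (r : R ⊆ (g *) (Eqrel Y))
                  (k : Hom (Qu₀ X R) Y) → k ∘ η X R ≡ g → k ≡ lift R g r

      UnitCartesian : Set (o ⊔ suc u)
      UnitCartesian = ∀ X (R : Ψ X) → R ≐ ((η X R) *) (Eqrel (Qu₀ X R))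

{-# OPTIONS --safe #-}
module Submission where

-- The quotient Y = Qu(X,R) with unit η is the candidate. Because λ is monotone, natural and
-- preserves equality, R ⊆ α*(λ R) ⊆ α*(λ(η*≡)) = (Fη ∘ α)*(≡), so Fη ∘ α is an ∫Ψ-morphism
-- (X,R) → Eq(FY) and factors through η as β ∘ η: this β makes η a coalgebra homomorphism.
-- Cartesianness of the unit is exactly the equality R = η*(≡).

open import Defs
open import Level using (Level)
open import Relation.Binary.PropositionalEquality
  using (_≡_; sym; trans; cong; subst; module ≡-Reasoning)
open import Data.Product using (Σ; _×_; _,_; proj₁)

module _ {o h : Level} (C : Category o h) (P : BinaryProducts C) where
  open Category C
  open BinaryProducts P

  ∘-⊗₁-proj : ∀ {A B D} {p : ∀ {Z} → Hom (Z ⊗ Z) Z} (g : Hom B D) (k : Hom A B) →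
              (∀ {Z W} (f : Hom Z W) → p ∘ (f ⊗₁ f) ≡ f ∘ p) →
              p ∘ ((g ⊗₁ g) ∘ (k ⊗₁ k)) ≡ (g ∘ k) ∘ p
  ∘-⊗₁-proj {p = p} g k p-nat = begin
    p ∘ ((g ⊗₁ g) ∘ (k ⊗₁ k))  ≡⟨ sym (assoc _ _ _) ⟩
    (p ∘ (g ⊗₁ g)) ∘ (k ⊗₁ k)  ≡⟨ cong (_∘ (k ⊗₁ k)) (p-nat g) ⟩
    (g ∘ p) ∘ (k ⊗₁ k)         ≡⟨ assoc _ _ _ ⟩
    g ∘ (p ∘ (k ⊗₁ k))         ≡⟨ cong (g ∘_) (p-nat k) ⟩
    g ∘ (k ∘ p)                ≡⟨ sym (assoc _ _ _) ⟩
    (g ∘ k) ∘ p                ∎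
    where open ≡-Reasoning

  ⊗₁-∘ : ∀ {A B D} (g : Hom B D) (k : Hom A B) →
         (g ⊗₁ g) ∘ (k ⊗₁ k) ≡ (g ∘ k) ⊗₁ (g ∘ k)
  ⊗₁-∘ g k = unique _ _ _
    (∘-⊗₁-proj g k (λ f → π₁-β (f ∘ π₁) (f ∘ π₂)))
    (∘-⊗₁-proj g k (λ f → π₂-β (f ∘ π₁) (f ∘ π₂)))

module _ {o h u : Level} (C : Category o h) (U : SetFunctor C u) (P : BinaryProducts C) where
  open Category C
  open SetFunctor U
  open BinaryProducts P
  open Relations C U P

  *-∘ : ∀ {A B D} (g : Hom B D) (k : Hom A B) (S : Ψ D) → (k *) ((g *) S) ⊆ ((g ∘ k) *) S
  *-∘ g k S z = subst S (trans (sym (∣∘∣ _ _ z)) (cong (λ m → ∣ m ∣₁ z) (⊗₁-∘ C P g k)))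

  module _ {F : Endofunctor C} (Λ : IndexedMorphism F) where
    open Endofunctor F
    open IndexedMorphism Λ

    ⊆-λ⇒⊆-F₁-*-Eqrel : (∀ X → λ₀ X (Eqrel X) ⊆ Eqrel (F₀ X)) →
                     ∀ {X Y} {R : Ψ X} (α : Hom X (F₀ X)) (e : Hom X Y) →
                     R ⊆ (α *) (λ₀ X R) → R ⊆ (e *) (Eqrel Y) →
                     R ⊆ ((F₁ e ∘ α) *) (Eqrel (F₀ Y))
    ⊆-λ⇒⊆-F₁-*-Eqrel λ-Eq α e R-λ R-e z Rz = *-∘ (F₁ e) α (Eqrel _) z
      (λ-Eq _ _ (proj₁ (nat e (Eqrel _)) _ (mono R-e _ (R-λ z Rz))))

theorem2 : {o h u : Level} (C : Category o h) (U : SetFunctor C u) (P : BinaryProducts C)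
    (F : Endofunctor C) →
    let open Category C
        open Endofunctor F
        open Relations C U P
    in (Λ : IndexedMorphism F) →
       (∀ X → IndexedMorphism.λ₀ Λ X (Eqrel X) ≐ Eqrel (F₀ X)) →
       (Qu : EqLeftAdjoint) →
       (X : Obj) (α : Hom X (F₀ X)) (R : Ψ X) →
       R ⊆ (α *) (IndexedMorphism.λ₀ Λ X R) →
       Σ Obj λ Y → Σ (Hom Y (F₀ Y)) λ β → Σ (Hom X Y) λ f →
         (F₁ f ∘ α ≡ β ∘ f)
         × (R ⊆ (f *) (Eqrel Y))
         × (EqLeftAdjoint.UnitCartesian Qu → R ≐ (f *) (Eqrel Y))
theorem2 C U P F Λ λ-Eq Qu X α R R-λ =
  Qu₀ X R , lift R (F₁ (η X R) ∘ α) R-Fηα , η X R ,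
  sym (lift-β R _ R-Fηα) , η-mor X R , (λ unit-cartesian → unit-cartesian X R)
  where
  open Category C
  open Endofunctor F
  open Relations C U P
  open EqLeftAdjoint Qu
  R-Fηα : R ⊆ ((F₁ (η X R) ∘ α) *) (Eqrel (F₀ (Qu₀ X R)))
  R-Fηα = ⊆-λ⇒⊆-F₁-*-Eqrel C U P Λ (λ Y → proj₁ (λ-Eq Y)) α (η X R) R-λ (η-mor X R)
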